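{- Let $D\ge 1$ and $d\in(\mathbb{N}^*)^D$ satisfy $d[D]\geq 3$ and $d[i] \geq 2 + 2\prod_{j=i+1}^{D} d[j]$ for all $i\in\{1,\dots,D-1\}$, and let $G_g=(V_g,E_g)$ be the grid graph yielded by $d$. If $\psi$ is a minimal translation on $G_g$, then there exists $i\in\{1,\dots,d[1]-1\}$ such that $\psi(v)\neq\bot$ for all $v\in V_g^{1,i}\cup V_g^{1,i+1}$.
   Context: A graph $G=(V,E)$ is finite, simple and undirected. Let $\bot$ be a symbol not in $V$. A transformation on $G$ is a map $\phi : V\cup\{\bot\} \to V \cup\{\bot\}$ with $\phi(\bot)=\bot$ that is injective on $V_{\not\bot} := \{v \in V : \phi(v) \neq \bot\}$; its loss is $\mathrm{loss}(\phi)=|\{v\in V : \phi(v)=\bot\}|$. It is edge-constrained (EC) if $\{v,\phi(v)\} \in E$ for all $v \in V_{\not\bot}$, and strongly neighborhood-preserving (SNP) if for all $v_1,v_2 \in V_{\not\bot}$: $\{v_1,v_2\}\in E \Leftrightarrow \{\phi(v_1),\phi(v_2)\} \in E$. A translation is an EC and SNP transformation; $\mathcal{T}(G)$ is the set of translations. For $\psi_1,\psi_2\in\mathcal{T}(G)$, $\psi_1 \prec \psi_2$ iff $\mathrm{loss}(\psi_1) > \mathrm{loss}(\psi_2)$ and there exists $v\in V$ with $\psi_1(v)=\psi_2(v)$; $\psi_1$ is minimal if no $\psi_2\in\mathcal{T}(G)$ satisfies $\psi_1\prec\psi_2$. The grid graph yielded by $d$ has $V_g = \{1,\dots,d[1]\}\times\cdots\times\{1,\dots,d[D]\}$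 and $\{v_1,v_2\}\in E_g$ iff there is $k$ with $|v_1[k]-v_2[k]|=1$ and $v_1[j]=v_2[j]$ for all $j\ne k$. The slice $V_g^{1,i}$ is $\{v\in V_g : v[1]=i\}$. -}

module Defs where

open import Data.Nat using (ℕ; zero; suc; _+_; _*_; _≤_; _<_)
open import Data.Fin using (Fin; toℕ)
open import Data.Vec using (Vec; []; _∷_; head)
open import Data.List using (List; concatMap; map; allFin; [_])
open import Data.Nat.ListAction using (sum)
open import Data.Maybe using (Maybe; just; nothing; maybe)
open import Data.Product using (Σ; ∃; ∃-syntax; _×_; _,_)
open import Data.Sum using (_⊎_)
open import Data.Empty using (⊥)
open import Relation.Binary.PropositionalEquality using (_≡_)
open import Relation.Nullary using (¬_)
open import Function using (_⇔_; const)

-- Grid graph yielded by d = (d[1], ..., d[D]) given as a Vec ℕ D.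
-- Coordinates are 0-indexed: coordinate k ranges over Fin (d[k]),
-- i.e. value c here corresponds to value c+1 in the paper.

data Vertex : {D : ℕ} → Vec ℕ D → Set where
  []  : Vertex []
  _∷_ : {D m : ℕ} {ds : Vec ℕ D} → Fin m → Vertex ds → Vertex (m ∷ ds)

vhead : {n : ℕ} {ds : Vec ℕ (suc n)} → Vertex ds → Fin (head ds)
vhead (x ∷ _) = x

Dist1 : ℕ → ℕ → Set
Dist1 a b = (a ≡ suc b) ⊎ (b ≡ suc a)

Adj : {D : ℕ} {ds : Vec ℕ D} → Vertex ds → Vertex ds → Set
Adj []      []      = ⊥
Adj (x ∷ u) (y ∷ w) = (Dist1 (toℕ x) (toℕ y) × u ≡ w) ⊎ (x ≡ y × Adj u w)

allVertices : {D : ℕ} (ds : Vec ℕ D) → List (Vertex ds)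
allVertices []       = [ [] ]
allVertices (m ∷ ds) = concatMap (λ x → map (x ∷_) (allVertices ds)) (allFin m)

-- Transformations: ⊥ is represented by nothing; φ(⊥) = ⊥ is implicit.

Transformation : {D : ℕ} → Vec ℕ D → Set
Transformation ds = Vertex ds → Maybe (Vertex ds)

InjectiveOnDefined : {D : ℕ} {ds : Vec ℕ D} → Transformation ds → Set
InjectiveOnDefined {ds = ds} φ =
  (u v x : Vertex ds) → φ u ≡ just x → φ v ≡ just x → u ≡ v

loss : {D : ℕ} {ds : Vec ℕ D} → Transformation ds → ℕ
loss {ds = ds} φ = sum (map (λ v → maybe (const 0) 1 (φ v)) (allVertices ds))

EC : {D : ℕ} {ds : Vec ℕ D} → Transformation ds → Set
EC {ds = ds} φ = (v x : Vertex ds) → φ v ≡ just x → Adj v x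

SNP : {D : ℕ} {ds : Vec ℕ D} → Transformation ds → Set
SNP {ds = ds} φ = (v₁ v₂ x₁ x₂ : Vertex ds) → φ v₁ ≡ just x₁ → φ v₂ ≡ just x₂ →
  (Adj v₁ v₂ ⇔ Adj x₁ x₂)

IsTranslation : {D : ℕ} {ds : Vec ℕ D} → Transformation ds → Set
IsTranslation φ = InjectiveOnDefined φ × EC φ × SNP φ

-- ψ₁ ≺ ψ₂ (both assumed translations where used)
_≺_ : {D : ℕ} {ds : Vec ℕ D} → Transformation ds → Transformation ds → Set
_≺_ {ds = ds} ψ₁ ψ₂ = loss ψ₂ < loss ψ₁ × ∃[ v ] (ψ₁ v ≡ ψ₂ v)

Minimal : {D : ℕ} {ds : Vec ℕ D} → Transformation ds → Set
Minimal {ds = ds} ψ₁ = ¬ (Σ (Transformation ds) λ ψ₂ → IsTranslation ψ₂ × (ψ₁ ≺ ψ₂))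

prodV : {D : ℕ} → Vec ℕ D → ℕ
prodV []       = 1
prodV (x ∷ xs) = x * prodV xs

GridCond : {n : ℕ} → Vec ℕ (suc n) → Set
GridCond (x ∷ [])       = 3 ≤ x
GridCond (x ∷ y ∷ ys)   = (2 + 2 * prodV (y ∷ ys) ≤ x) × GridCond (y ∷ ys)

data AllPos : {D : ℕ} → Vec ℕ D → Set where
  []  : AllPos []
  _∷_ : {D m : ℕ} {ds : Vec ℕ D} → 1 ≤ m → AllPos ds → AllPos (m ∷ ds)

module Submission where

-- A minimal translation ψ loses at most P = d[2]⋯d[D] vertices, the size of a slice. Indeed, if some
-- vertex of the first slice is lost, ψ agrees there with the translation shifting every vertex down in
-- the first coordinate, and if one is moved to the second slice, ψ agrees there with the shift up;
-- each shift loses exactly one slice, so minimality bounds loss ψ by P. Otherwise ψ maps the first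
-- slice into itself by a translation σ of the remaining coordinates, and applying σ in every slice is
-- a lossless translation agreeing with ψ, so loss ψ = 0. Once loss ψ ≤ P and d[1] ≥ 2 + 2P, the d[1]
-- slices contain at least P + 1 disjoint consecutive pairs, one of which loses nothing. The remaining
-- case d = (3) has P = 1, and the single lost vertex cannot be the middle one, for then both endpoints
-- would be mapped to it.

open import Defs
open import Data.Nat using (ℕ; zero; suc; _+_; _*_; _≤_; _<_; z≤n; s≤s; _≟_; _≤?_)
open import Data.Nat.Properties
open import Data.Nat.ListAction using (sum)
open import Data.Nat.ListAction.Properties using (sum-++)
open import Data.Fin as Fin using (Fin; zero; suc; toℕ; inject₁)
open import Data.Fin.Properties using (toℕ-injective; toℕ<n; toℕ-inject₁)
open import Data.Vec using (Vec; head; []; _∷_)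
open import Data.List using (List; []; _∷_; map; concat; concatMap; tabulate; allFin; length)
open import Data.List.Properties
  using (map-∘; map-cong; map-concatMap; map-tabulate; tabulate-cong; length-++; length-map; length-tabulate)
open import Data.List.Membership.Propositional using (_∈_)
open import Data.List.Membership.Propositional.Properties using (∈-map⁺; ∈-concatMap⁺; ∈-allFin)
open import Data.List.Relation.Unary.Any using (here; there) renaming (map to any-map)
open import Data.Maybe using (Maybe; just; nothing; maybe)
open import Data.Maybe.Properties using (just-injective)
import Data.Maybe as Maybe
open import Data.Product using (∃-syntax; ∃₂; _×_; _,_; proj₁; proj₂)
open import Data.Product.Function.NonDependent.Propositional using (_×-⇔_)
open import Data.Sum using (_⊎_; inj₁; inj₂; [_,_])
import Data.Sum as Sum
open import Data.Sum.Function.Propositional using (_⊎-⇔_)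
open import Relation.Nullary using (¬_; yes; no; contradiction)
open import Relation.Binary.PropositionalEquality
  using (_≡_; _≢_; refl; sym; trans; cong; cong₂; subst; module ≡-Reasoning)
open import Function using (_⇔_; _∘_; const; id; mk⇔; Equivalence)
open import Function.Properties.Equivalence using ()
  renaming (refl to ⇔-refl; sym to ⇔-sym; trans to ⇔-trans)

open Equivalence using (to)

private
  variable
    A B : Set
    D m : ℕ
    ds : Vec ℕ D

sum-concat : (xss : List (List ℕ)) → sum (concat xss) ≡ sum (map sum xss)
sum-concat []         = refl
sum-concat (xs ∷ xss) = trans (sum-++ xs (concat xss)) (cong (sum xs +_) (sum-concat xss))

sum-map-concatMap : (g : A → List B) (h : B → ℕ) (xs : List A) →
                    sum (map h (concatMap g xs)) ≡ sum (map (sum ∘ map h ∘ g) xs)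
sum-map-concatMap g h xs = begin
  sum (map h (concatMap g xs))       ≡⟨ cong sum (map-concatMap h g xs) ⟩
  sum (concatMap (map h ∘ g) xs)     ≡⟨ sum-concat (map (map h ∘ g) xs) ⟩
  sum (map sum (map (map h ∘ g) xs)) ≡⟨ cong sum (map-∘ xs) ⟨
  sum (map (sum ∘ map h ∘ g) xs)     ∎
  where open ≡-Reasoning

sum-map-const : ∀ {c} (h : A → ℕ) → (∀ x → h x ≡ c) → (xs : List A) → sum (map h xs) ≡ length xs * c
sum-map-const h h≡c []       = refl
sum-map-const h h≡c (x ∷ xs) = cong₂ _+_ (h≡c x) (sum-map-const h h≡c xs)

sum-map≡0 : (h : A → ℕ) {xs : List A} → sum (map h xs) ≡ 0 → ∀ {x} → x ∈ xs → h x ≡ 0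
sum-map≡0 h {y ∷ _}  Σ≡0 (here refl) = m+n≡0⇒m≡0 (h y) Σ≡0
sum-map≡0 h {y ∷ xs} Σ≡0 (there x∈) = sum-map≡0 h (m+n≡0⇒n≡0 (h y) Σ≡0) x∈

sum-tabulate-*ˡ : ∀ {n} c (f : Fin n → ℕ) → sum (tabulate (λ i → c * f i)) ≡ c * sum (tabulate f)
sum-tabulate-*ˡ {zero}  c f = sym (*-zeroʳ c)
sum-tabulate-*ˡ {suc n} c f =
  trans (cong (c * f zero +_) (sum-tabulate-*ˡ c (f ∘ suc))) (sym (*-distribˡ-+ c (f zero) _))

sum-tabulate-zero : ∀ n → sum (tabulate {n = n} (const 0)) ≡ 0
sum-tabulate-zero zero    = refl
sum-tabulate-zero (suc n) = sum-tabulate-zero n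

length-concatMap : ∀ {c} (g : A → List B) → (∀ x → length (g x) ≡ c) → (xs : List A) →
                   length (concatMap g xs) ≡ length xs * c
length-concatMap g len≡c []       = refl
length-concatMap g len≡c (x ∷ xs) =
  trans (length-++ (g x)) (cong₂ _+_ (len≡c x) (length-concatMap g len≡c xs))

∷-injective : {x y : Fin m} {u w : Vertex ds} → _≡_ {A = Vertex (m ∷ ds)} (x ∷ u) (y ∷ w) → x ≡ y × u ≡ w
∷-injective refl = refl , refl

vertex : AllPos ds → Vertex ds
vertex []           = []
vertex (s≤s _ ∷ ps) = zero ∷ vertex ps

allVertices-complete : (ds : Vec ℕ D) (u : Vertex ds) → u ∈ allVertices ds
allVertices-complete []       []      = here refl
allVertices-complete (m ∷ ds) (x ∷ u) =
  ∈-concatMap⁺ (λ y → map (y ∷_) (allVertices ds))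
    (any-map (λ { refl → ∈-map⁺ (x ∷_) (allVertices-complete ds u) }) (∈-allFin x))

length-allVertices : (ds : Vec ℕ D) → length (allVertices ds) ≡ prodV ds
length-allVertices []       = refl
length-allVertices (m ∷ ds) = trans
  (length-concatMap _ (λ x → trans (length-map (Vertex._∷_ x) (allVertices ds)) (length-allVertices ds))
                      (allFin m))
  (cong (_* prodV ds) (length-tabulate {n = m} id))

Dist1-irrefl : ∀ n → ¬ Dist1 n n
Dist1-irrefl n = [ 1+n≢n ∘ sym , 1+n≢n ∘ sym ]

Dist1-suc : ∀ {a b a′ b′} → a′ ≡ suc a → b′ ≡ suc b → Dist1 a b ⇔ Dist1 a′ b′
Dist1-suc refl refl = mk⇔ (Sum.map (cong suc) (cong suc)) (Sum.map suc-injective suc-injective)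

Adj-sameHead : {x : Fin m} {u w : Vertex ds} → Adj (x ∷ u) (x ∷ w) ⇔ Adj u w
Adj-sameHead {x = x} =
  mk⇔ [ (λ (d , _) → contradiction d (Dist1-irrefl (toℕ x))) , proj₂ ] (λ a → inj₂ (refl , a))

lost : Maybe A → ℕ
lost = maybe (const 0) 1

lost-map : (f : A → B) (mx : Maybe A) → lost (Maybe.map f mx) ≡ lost mx
lost-map f nothing  = refl
lost-map f (just _) = refl

sliceLoss : Transformation (m ∷ ds) → Fin m → ℕ
sliceLoss {ds = ds} ψ x = sum (map (λ u → lost (ψ (x ∷ u))) (allVertices ds))

loss-slices : (ψ : Transformation (m ∷ ds)) → loss ψ ≡ sum (tabulate (sliceLoss ψ))
loss-slices {m = m} {ds = ds} ψ = begin
  loss ψ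
    ≡⟨ sum-map-concatMap (λ x → map (x ∷_) (allVertices ds)) (lost ∘ ψ) (allFin m) ⟩
  sum (map (λ x → sum (map (lost ∘ ψ) (map (x ∷_) (allVertices ds)))) (allFin m))
    ≡⟨ cong sum (map-cong (λ x → cong sum (map-∘ (allVertices ds)) ) (allFin m)) ⟨
  sum (map (sliceLoss ψ) (allFin m))
    ≡⟨ cong sum (map-tabulate id (sliceLoss ψ)) ⟩
  sum (tabulate (sliceLoss ψ)) ∎
  where open ≡-Reasoning

DefinedSlice : Transformation (m ∷ ds) → Fin m → Set
DefinedSlice ψ x = ∀ u → ψ (x ∷ u) ≢ nothing

sliceLoss≡0⇒defined : (ψ : Transformation (m ∷ ds)) {x : Fin m} → sliceLoss ψ x ≡ 0 → DefinedSlice ψ x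
sliceLoss≡0⇒defined {ds = ds} ψ sl≡0 u ψxu≡nothing =
  contradiction (trans (cong lost (sym ψxu≡nothing)) (sum-map≡0 _ sl≡0 (allVertices-complete ds u))) λ ()

loss-total : (f : Vertex ds → Vertex ds) → loss (just ∘ f) ≡ 0
loss-total {ds = ds} f =
  trans (sum-map-const (const 0) (λ _ → refl) (allVertices ds)) (*-zeroʳ (length (allVertices ds)))

minimal⇒loss≤ : {ψ φ : Transformation ds} → Minimal ψ → IsTranslation φ → ∀ v → ψ v ≡ φ v → loss ψ ≤ loss φ
minimal⇒loss≤ {φ = φ} minψ trφ v ψv≡φv = ≮⇒≥ λ lt → minψ (φ , trφ , lt , v , ψv≡φv)

IsLineTranslation : (Fin m → Maybe (Fin m)) → Set
IsLineTranslation s =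
  (∀ x y z → s x ≡ just z → s y ≡ just z → x ≡ y) ×
  (∀ x y → s x ≡ just y → Dist1 (toℕ x) (toℕ y)) ×
  (∀ x y x′ y′ → s x ≡ just x′ → s y ≡ just y′ → Dist1 (toℕ x) (toℕ y) ⇔ Dist1 (toℕ x′) (toℕ y′))

onHead : (Fin m → Maybe (Fin m)) → Transformation (m ∷ ds)
onHead s (x ∷ u) = Maybe.map (_∷ u) (s x)

onHead-translation : {s : Fin m → Maybe (Fin m)} → IsLineTranslation s →
                     IsTranslation (onHead {ds = ds} s)
onHead-translation {s = s} (injˢ , ecˢ , snpˢ) = inj , ec , snp
  where
  sameImage⇔ : ∀ {x y x′ y′} → s x ≡ just x′ → s y ≡ just y′ → x ≡ y ⇔ x′ ≡ y′
  sameImage⇔ {x} {y} {x′} {y′} sx sy = mk⇔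
    (λ { refl → just-injective (trans (sym sx) sy) })
    (λ { refl → injˢ x y y′ sx sy })

  inj : InjectiveOnDefined (onHead s)
  inj (x ∷ u) (y ∷ w) z e₁ e₂ with s x in sx | s y in sy
  inj (x ∷ u) (y ∷ .u) .(x′ ∷ u) refl refl | just x′ | just .x′ = cong (_∷ u) (injˢ x y x′ sx sy)

  ec : EC (onHead s)
  ec (x ∷ u) z e with s x in sx
  ec (x ∷ u) .(x′ ∷ u) refl | just x′ = inj₁ (ecˢ x x′ sx , refl)

  snp : SNP (onHead s)
  snp (x ∷ u) (y ∷ w) z₁ z₂ e₁ e₂ with s x in sx | s y in sy
  snp (x ∷ u) (y ∷ w) .(x′ ∷ u) .(y′ ∷ w) refl refl | just x′ | just y′ =
    (snpˢ x y x′ y′ sx sy ×-⇔ ⇔-refl) ⊎-⇔ (sameImage⇔ sx sy ×-⇔ ⇔-refl)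

ascending-lineTranslation : {s : Fin m → Maybe (Fin m)} →
  (∀ {x y} → s x ≡ just y → toℕ y ≡ suc (toℕ x)) → IsLineTranslation s
ascending-lineTranslation asc =
  (λ x y z sx sy → toℕ-injective (suc-injective (trans (sym (asc sx)) (asc sy)))) ,
  (λ x y sx → inj₂ (asc sx)) ,
  (λ x y x′ y′ sx sy → Dist1-suc (asc sx) (asc sy))

descending-lineTranslation : {s : Fin m → Maybe (Fin m)} →
  (∀ {x y} → s x ≡ just y → toℕ x ≡ suc (toℕ y)) → IsLineTranslation s
descending-lineTranslation desc =
  (λ x y z sx sy → toℕ-injective (trans (desc sx) (sym (desc sy)))) ,
  (λ x y sx → inj₁ (desc sx)) ,
  (λ x y x′ y′ sx sy → ⇔-sym (Dist1-suc (desc sx) (desc sy)))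

stepUp : Fin m → Maybe (Fin m)
stepUp {suc zero}    zero    = nothing
stepUp {suc (suc m)} zero    = just (suc zero)
stepUp {suc (suc m)} (suc x) = Maybe.map suc (stepUp x)

stepDown : Fin m → Maybe (Fin m)
stepDown zero    = nothing
stepDown (suc x) = just (inject₁ x)

stepUp-toℕ : {x y : Fin m} → stepUp x ≡ just y → toℕ y ≡ suc (toℕ x)
stepUp-toℕ {suc (suc m)} {zero}  refl = refl
stepUp-toℕ {suc (suc m)} {suc x} e with stepUp x in e′
stepUp-toℕ {suc (suc m)} {suc x} refl | just y = cong suc (stepUp-toℕ e′)

stepDown-toℕ : {x y : Fin m} → stepDown x ≡ just y → toℕ x ≡ suc (toℕ y)
stepDown-toℕ {x = suc x} refl = cong suc (sym (toℕ-inject₁ x))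

lost-stepUp : ∀ m → sum (tabulate (lost ∘ stepUp {suc m})) ≡ 1
lost-stepUp zero    = refl
lost-stepUp (suc m) =
  trans (cong sum (tabulate-cong {n = suc m} (λ x → lost-map Fin.suc (stepUp x)))) (lost-stepUp m)

lost-stepDown : ∀ m → sum (tabulate (lost ∘ stepDown {suc m})) ≡ 1
lost-stepDown m = cong suc (sum-tabulate-zero m)

loss-onHead : (s : Fin m → Maybe (Fin m)) → loss (onHead {ds = ds} s) ≡ prodV ds * sum (tabulate (lost ∘ s))
loss-onHead {ds = ds} s = begin
  loss (onHead s)                              ≡⟨ loss-slices (onHead s) ⟩
  sum (tabulate (sliceLoss (onHead {ds = ds} s))) ≡⟨ cong sum (tabulate-cong sliceLoss-onHead) ⟩
  sum (tabulate (λ x → prodV ds * lost (s x))) ≡⟨ sum-tabulate-*ˡ (prodV ds) (lost ∘ s) ⟩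
  prodV ds * sum (tabulate (lost ∘ s))         ∎
  where
  open ≡-Reasoning
  sliceLoss-onHead : ∀ x → sliceLoss (onHead {ds = ds} s) x ≡ prodV ds * lost (s x)
  sliceLoss-onHead x = trans (sum-map-const _ (λ u → lost-map (λ y → y ∷ u) (s x)) (allVertices ds))
                             (cong (_* lost (s x)) (length-allVertices ds))

loss-onHead≡sliceSize : (s : Fin m → Maybe (Fin m)) → sum (tabulate (lost ∘ s)) ≡ 1 →
                        loss (onHead {ds = ds} s) ≡ prodV ds
loss-onHead≡sliceSize {ds = ds} s one =
  trans (loss-onHead s) (trans (cong (prodV ds *_) one) (*-identityʳ (prodV ds)))

onTail : (Vertex ds → Vertex ds) → Vertex (m ∷ ds) → Vertex (m ∷ ds)
onTail σ (x ∷ u) = x ∷ σ u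

onTail-translation : {σ : Vertex ds → Vertex ds} → IsTranslation (just ∘ σ) →
                     IsTranslation (just ∘ onTail {m = m} σ)
onTail-translation {σ = σ} (injσ , ecσ , snpσ) = inj , ec , snp
  where
  σ-injective : ∀ {u w} → σ u ≡ σ w → u ≡ w
  σ-injective {u} {w} σu≡σw = injσ u w (σ w) (cong just σu≡σw) refl

  inj : InjectiveOnDefined (just ∘ onTail σ)
  inj (x ∷ u) (y ∷ w) z e₁ e₂ with ∷-injective (just-injective (trans e₁ (sym e₂)))
  ... | refl , σu≡σw = cong (x ∷_) (σ-injective σu≡σw)

  ec : EC (just ∘ onTail σ)
  ec (x ∷ u) _ refl = inj₂ (refl , ecσ u (σ u) refl)

  snp : SNP (just ∘ onTail σ)
  snp (x ∷ u) (y ∷ w) _ _ refl refl =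
    (⇔-refl ×-⇔ mk⇔ (cong σ) σ-injective) ⊎-⇔ (⇔-refl ×-⇔ snpσ u w (σ u) (σ w) refl refl)

sliceRestriction-translation : {ψ : Transformation (m ∷ ds)} {x : Fin m} {σ : Vertex ds → Vertex ds} →
  IsTranslation ψ → (∀ u → ψ (x ∷ u) ≡ just (x ∷ σ u)) → IsTranslation (just ∘ σ)
sliceRestriction-translation {x = x} {σ} (injψ , ecψ , snpψ) ψx≡σ = inj , ec , snp
  where
  inj : InjectiveOnDefined (just ∘ σ)
  inj u w _ refl σw≡σu = proj₂ (∷-injective (injψ (x ∷ u) (x ∷ w) (x ∷ σ u) (ψx≡σ u)
    (trans (ψx≡σ w) (cong (λ t → just (x ∷ t)) (just-injective σw≡σu)))))

  ec : EC (just ∘ σ)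
  ec u _ refl = to Adj-sameHead (ecψ (x ∷ u) (x ∷ σ u) (ψx≡σ u))

  snp : SNP (just ∘ σ)
  snp u w _ _ refl refl =
    ⇔-trans (⇔-sym Adj-sameHead) (⇔-trans (snpψ _ _ _ _ (ψx≡σ u) (ψx≡σ w)) Adj-sameHead)

-- A minimal translation loses at most one slice

module _ {k} {ψ : Transformation (suc (suc k) ∷ ds)} (trψ : IsTranslation ψ) (minψ : Minimal ψ) where

  private
    sliceSize<loss⇒¬agree : ∀ {s} → prodV ds < loss ψ → IsLineTranslation s → sum (tabulate (lost ∘ s)) ≡ 1 →
                            ∀ v → ψ v ≢ onHead s v
    sliceSize<loss⇒¬agree {s} P<loss trˢ one v ψv≡ = <⇒≱ P<loss (begin
      loss ψ                     ≤⟨ minimal⇒loss≤ minψ (onHead-translation trˢ) v ψv≡ ⟩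
      loss (onHead {ds = ds} s)  ≡⟨ loss-onHead≡sliceSize {ds = ds} s one ⟩
      prodV ds                   ∎)
      where open ≤-Reasoning

  firstSlice-invariant : prodV ds < loss ψ → ∀ u → ∃[ w ] ψ (zero ∷ u) ≡ just (zero ∷ w)
  firstSlice-invariant P<loss u with ψ (zero ∷ u) in ψ0u
  ... | nothing = contradiction ψ0u
        (sliceSize<loss⇒¬agree P<loss
          (descending-lineTranslation stepDown-toℕ) (lost-stepDown (suc k)) (zero ∷ u))
  ... | just (x ∷ w) with proj₁ (proj₂ trψ) (zero ∷ u) (x ∷ w) ψ0u
  ...   | inj₂ (refl , _) = w , refl
  ...   | inj₁ (d , refl) = contradiction d (notToSecondSlice x ψ0u)
    where
    notToSecondSlice : ∀ x → ψ (zero ∷ u) ≡ just (x ∷ u) → ¬ Dist1 0 (toℕ x)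
    notToSecondSlice zero          _     = Dist1-irrefl 0
    notToSecondSlice (suc zero)    ψ0u _ = sliceSize<loss⇒¬agree P<loss
      (ascending-lineTranslation stepUp-toℕ) (lost-stepUp (suc k)) (zero ∷ u) ψ0u
    notToSecondSlice (suc (suc _)) _     = [ (λ ()) , (λ ()) ]

  minimal⇒loss≤sliceSize : Vertex ds → loss ψ ≤ prodV ds
  minimal⇒loss≤sliceSize u₀ with loss ψ ≤? prodV ds
  ... | yes loss≤P = loss≤P
  ... | no  loss≰P = contradiction (begin
      loss ψ
        ≤⟨ minimal⇒loss≤ minψ (onTail-translation trσ) (zero ∷ u₀) (proj₂ (invariant u₀)) ⟩
      loss (just ∘ onTail {m = suc (suc k)} σ)
        ≡⟨ loss-total (onTail {m = suc (suc k)} σ) ⟩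
      0 ∎) (<⇒≱ (≤-<-trans z≤n P<loss))
    where
    open ≤-Reasoning
    P<loss = ≰⇒> loss≰P
    invariant = firstSlice-invariant P<loss
    σ : Vertex ds → Vertex ds
    σ u = proj₁ (invariant u)
    trσ = sliceRestriction-translation trψ (proj₂ ∘ invariant)

Consecutively : (Fin m → Set) → Set
Consecutively {m} P = ∃₂ λ (i j : Fin m) → toℕ j ≡ suc (toℕ i) × P i × P j

Consecutively-map : {P Q : Fin m → Set} → (∀ {i} → P i → Q i) → Consecutively P → Consecutively Q
Consecutively-map P⇒Q (i , j , j≡i+1 , pᵢ , pⱼ) = i , j , j≡i+1 , P⇒Q pᵢ , P⇒Q pⱼ

pair-bound : ∀ a b {s k} → 1 ≤ a + b → 2 * (a + (b + s)) ≤ k → 2 + 2 * s ≤ k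
pair-bound a b {s} {k} 1≤a+b 2S≤k = begin
  2 + 2 * s          ≡⟨ *-distribˡ-+ 2 1 s ⟨
  2 * (1 + s)        ≤⟨ *-monoʳ-≤ 2 (+-monoˡ-≤ s 1≤a+b) ⟩
  2 * ((a + b) + s)  ≡⟨ cong (2 *_) (+-assoc a b s) ⟩
  2 * (a + (b + s))  ≤⟨ 2S≤k ⟩
  k                  ∎
  where open ≤-Reasoning

consecutiveZeros : (f : Fin m → ℕ) → 2 + 2 * sum (tabulate f) ≤ m → Consecutively (λ i → f i ≡ 0)
consecutiveZeros {suc (suc k)} f (s≤s (s≤s 2S≤k)) with f zero + f (suc zero) ≟ 0
... | yes f₀+f₁≡0 = zero , suc zero , refl , m+n≡0⇒m≡0 _ f₀+f₁≡0 , m+n≡0⇒n≡0 _ f₀+f₁≡0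
... | no  f₀+f₁≢0
  with consecutiveZeros (f ∘ Fin.suc ∘ Fin.suc) (pair-bound (f zero) (f (suc zero)) (n≢0⇒n>0 f₀+f₁≢0) 2S≤k)
...   | i , j , j≡i+1 , fi≡0 , fj≡0 = suc (suc i) , suc (suc j) , cong (2 +_) j≡i+1 , fi≡0 , fj≡0

TwoDefinedSlices : Transformation (m ∷ ds) → Set
TwoDefinedSlices {m} {ds = ds} ψ = ∃[ i ] (suc i < m ×
  ((v : Vertex (m ∷ ds)) → (toℕ (vhead v) ≡ i ⊎ toℕ (vhead v) ≡ suc i) → ψ v ≢ nothing))

consecutivelyDefined⇒TwoDefinedSlices : {ψ : Transformation (m ∷ ds)} →
  Consecutively (DefinedSlice ψ) → TwoDefinedSlices ψ
consecutivelyDefined⇒TwoDefinedSlices {m} (i , j , j≡i+1 , defᵢ , defⱼ) =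
  toℕ i , subst (_< m) j≡i+1 (toℕ<n j) , defined
  where
  defined : ∀ v → toℕ (vhead v) ≡ toℕ i ⊎ toℕ (vhead v) ≡ suc (toℕ i) → _
  defined (x ∷ u) (inj₁ x≡i) rewrite toℕ-injective x≡i = defᵢ u
  defined (x ∷ u) (inj₂ x≡i+1) rewrite toℕ-injective (trans x≡i+1 (sym j≡i+1)) = defⱼ u

lossBound⇒TwoDefinedSlices : (ψ : Transformation (m ∷ ds)) → 2 + 2 * loss ψ ≤ m → TwoDefinedSlices ψ
lossBound⇒TwoDefinedSlices ψ bound = consecutivelyDefined⇒TwoDefinedSlices
  (Consecutively-map (sliceLoss≡0⇒defined ψ)
    (consecutiveZeros (sliceLoss ψ) (subst (λ l → 2 + 2 * l ≤ _) (loss-slices ψ) bound)))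

minimal⇒TwoDefinedSlices : {ψ : Transformation (m ∷ ds)} → Vertex ds → 2 + 2 * prodV ds ≤ m →
                           IsTranslation ψ → Minimal ψ → TwoDefinedSlices ψ
minimal⇒TwoDefinedSlices u₀ bound@(s≤s (s≤s _)) trψ minψ = lossBound⇒TwoDefinedSlices _
  (≤-trans (+-monoʳ-≤ 2 (*-monoʳ-≤ 2 (minimal⇒loss≤sliceSize trψ minψ u₀))) bound)

-- The path with three vertices

middle : Vertex (3 ∷ [])
middle = suc zero ∷ []

pathOfThree-edge : {v w : Vertex (3 ∷ [])} → Adj v w → v ≢ middle → w ≡ middle
pathOfThree-edge {_ ∷ []} {_ ∷ []} (inj₂ (_ , ()))
pathOfThree-edge {suc zero ∷ []} _ v≢middle = contradiction refl v≢middle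
pathOfThree-edge {_} {suc zero ∷ []} _ _ = refl
pathOfThree-edge {zero ∷ []} {zero ∷ []} (inj₁ (d , _)) _ = contradiction d (Dist1-irrefl 0)
pathOfThree-edge {suc (suc zero) ∷ []} {suc (suc zero) ∷ []} (inj₁ (d , _)) _ = contradiction d (Dist1-irrefl 2)
pathOfThree-edge {zero ∷ []} {suc (suc zero) ∷ []} (inj₁ (d , _)) _ = contradiction d [ (λ ()) , (λ ()) ]
pathOfThree-edge {suc (suc zero) ∷ []} {zero ∷ []} (inj₁ (d , _)) _ = contradiction d [ (λ ()) , (λ ()) ]

pathOfThree : {ψ : Transformation (3 ∷ [])} → IsTranslation ψ → loss ψ ≤ 1 → TwoDefinedSlices ψ
pathOfThree {ψ} (injψ , ecψ , _) = cases
  where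
  v₀ v₂ : Vertex (3 ∷ [])
  v₀ = zero ∷ []
  v₂ = suc (suc zero) ∷ []

  defined : ∀ {x w} → ψ (x ∷ []) ≡ just w → DefinedSlice ψ x
  defined ψx≡w [] ψx≡nothing = contradiction (trans (sym ψx≡w) ψx≡nothing) λ ()

  toMiddle : ∀ {v w} → v ≢ middle → ψ v ≡ just w → ψ v ≡ just middle
  toMiddle v≢middle ψv≡w = trans ψv≡w (cong just (pathOfThree-edge (ecψ _ _ ψv≡w) v≢middle))

  -- loss ψ ≤ 1 unfolded, so that the with-abstraction below reaches the three values
  cases : lost (ψ v₀) + (lost (ψ middle) + (lost (ψ v₂) + 0)) ≤ 1 → TwoDefinedSlices ψ
  cases loss≤1 with ψ v₀ in ψ₀ | ψ middle in ψ₁ | ψ v₂ in ψ₂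
  ... | just _  | just _  | _       = consecutivelyDefined⇒TwoDefinedSlices
                                        (zero , suc zero , refl , defined ψ₀ , defined ψ₁)
  ... | nothing | just _  | just _  = consecutivelyDefined⇒TwoDefinedSlices
                                        (suc zero , suc (suc zero) , refl , defined ψ₁ , defined ψ₂)
  ... | just _  | nothing | just _  =
    contradiction (injψ v₀ v₂ middle (toMiddle (λ ()) ψ₀) (toMiddle (λ ()) ψ₂)) λ ()
  ... | nothing | nothing | _       = contradiction loss≤1 λ { (s≤s ()) }
  ... | nothing | just _  | nothing = contradiction loss≤1 λ { (s≤s ()) }
  ... | just _  | nothing | nothing = contradiction loss≤1 λ { (s≤s ()) }

lemma2 : {n : ℕ} (d : Vec ℕ (suc n)) → AllPos d → GridCond d →
    (ψ : Transformation d) → IsTranslation ψ → Minimal ψ →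
    ∃[ i ] (suc i < head d ×
      ((v : Vertex d) → (toℕ (vhead v) ≡ i ⊎ toℕ (vhead v) ≡ suc i) → ψ v ≢ nothing))
lemma2 (_ ∷ _ ∷ _) (_ ∷ pos) (bound , _) ψ trψ minψ = minimal⇒TwoDefinedSlices (vertex pos) bound trψ minψ
lemma2 (_ ∷ []) _ (s≤s (s≤s (s≤s (z≤n {zero})))) ψ trψ minψ =
  pathOfThree trψ (minimal⇒loss≤sliceSize trψ minψ [])
lemma2 (_ ∷ []) _ (s≤s (s≤s (s≤s (z≤n {suc _})))) ψ trψ minψ =
  minimal⇒TwoDefinedSlices [] (s≤s (s≤s (s≤s (s≤s z≤n)))) trψ minψ
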